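{- Let $U, V$ be groups with $Z(V)$ $2$-divisible, let $U' \subset U$ be a subgroup of index $2$, and fix $\mu \in U \setminus U'$. Let $\psi: U' \to V$ be a homomorphism such that (i) $\{v \in V : v\psi(u)v^{ -1} = \psi(u)\ \forall u \in U'\} = Z(V)$, and (ii) the homomorphism $\psi^\mu: U' \to V$, $\psi^\mu(u) = \psi(\mu u \mu^{ -1})$, is conjugate in $V$ to $\psi$. Then $\psi$ extends to a homomorphism $U \to V$. -}

module Defs where

open import Level using (Level; _⊔_; suc)
open import Algebra.Bundles using (Group)
open import Algebra.Morphism.Structures using (module GroupMorphisms)
open import Data.Product using (Σ; _×_; ∃)
open import Data.Sum using (_⊎_)
open import Relation.Nullary using (¬_)

private variable c ℓ c₂ ℓ₂ p : Level

record Subgroup (G : Group c ℓ) (p : Level) : Set (c ⊔ ℓ ⊔ suc p) where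
  open Group G
  field
    mem       : Carrier → Set p
    mem-resp   : ∀ {x y} → x ≈ y → mem x → mem y
    ε-closed   : mem ε
    ∙-closed   : ∀ {x y} → mem x → mem y → mem (x ∙ y)
    ⁻¹-closed  : ∀ {x} → mem x → mem (x ⁻¹)

-- H has index 2 in G: there is g ∉ H such that the (left) cosets H and gH
-- cover G, i.e. G = H ⊔ gH (the two cosets are disjoint since g ∉ H).
IndexTwo : {G : Group c ℓ} → Subgroup G p → Set (c ⊔ p)
IndexTwo {G = G} H = Σ Carrier λ g → ¬ (mem g) × (∀ x → (mem x) ⊎ mem (g ⁻¹ ∙ x))
  where open Group G
        open Subgroup H

record SubgroupHom {G : Group c ℓ} (H : Subgroup G p) (V : Group c₂ ℓ₂)
       : Set (c ⊔ ℓ ⊔ p ⊔ c₂ ⊔ ℓ₂) where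
  private module G = Group G
  private module V = Group V
  open Subgroup H
  field
    f      : (x : G.Carrier) → mem x → V.Carrier
    f-cong : ∀ {x y} (hx : mem x) (hy : mem y) → x G.≈ y → f x hx V.≈ f y hy
    f-∙    : ∀ {x y} (hx : mem x) (hy : mem y) →
             f (x G.∙ y) (∙-closed hx hy) V.≈ (f x hx V.∙ f y hy)

Central : (V : Group c ℓ) → Group.Carrier V → Set (c ⊔ ℓ)
Central V z = ∀ w → (z ∙ w) ≈ (w ∙ z)
  where open Group V

CentreTwoDivisible : Group c ℓ → Set (c ⊔ ℓ)
CentreTwoDivisible V = ∀ z → Central V z → ∃ λ y → Central V y × ((y ∙ y) ≈ z)
  where open Group V

IsGroupHom : (G : Group c ℓ) (V : Group c₂ ℓ₂) → (Group.Carrier G → Group.Carrier V) → Set _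
IsGroupHom G V φ = GroupMorphisms.IsGroupHomomorphism (Group.rawGroup G) (Group.rawGroup V) φ

-- Every
-- x ∈ U lies either in U′ or in μU′, so a map φ : U → V extending ψ is
-- determined by one value w = φ(μ):  φ(x) = ψ(x) on U′ and φ(x) = w ψ(μ⁻¹x)
-- on μU′.  This φ is a homomorphism as soon as
--   (a) w intertwines ψ^μ with ψ:  ψ(μuμ⁻¹) w = w ψ(u) for u ∈ U′, and
--   (b) w squares to ψ(μ²)  (note μ² ∈ U′).
-- Hypothesis (ii) provides v satisfying (a).  Both v² and ψ(μ²) intertwine
-- ψ^{μ²} with ψ, so z = ψ(μ²)⁻¹ v² centralises ψ(U′) and is central in V by
-- hypothesis (i).  Choosing a central square root y of z⁻¹ (Z(V) is
-- 2-divisible), w = v y still satisfies (a) and now also (b).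
module Submission where

open import Defs
open import Level using (Level)
open import Algebra.Bundles using (Group)
open import Data.Product using (Σ; _×_; ∃; _,_)
open import Data.Sum using (_⊎_; inj₁; inj₂)
open import Data.Empty using (⊥-elim)
open import Function.Bundles using (_⇔_; Equivalence)
open import Relation.Nullary using (¬_)
import Algebra.Properties.Group as GroupProperties
import Relation.Binary.Reasoning.Setoid as SetoidReasoning

module Identities {a ℓ : Level} (G : Group a ℓ) where
  open Group G
  open GroupProperties G public
    using (⁻¹-involutive; ⁻¹-anti-homo-∙; identityˡ-unique; inverseˡ-unique)
    renaming ( \\-leftDividesˡ to x∙[x⁻¹∙y]≈y ; \\-leftDividesʳ to x⁻¹∙[x∙y]≈y
             ; //-rightDividesˡ to y∙x⁻¹∙x≈y ; //-rightDividesʳ to y∙x∙x⁻¹≈y )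
  open SetoidReasoning setoid

  conj⇒intertwine : ∀ {X v u} → X ≈ v ∙ u ∙ v ⁻¹ → X ∙ v ≈ v ∙ u
  conj⇒intertwine {v = v} {u} X≈ = trans (∙-congʳ X≈) (y∙x⁻¹∙x≈y v (v ∙ u))

  commute⇒conj-fixed : ∀ {z u} → z ∙ u ≈ u ∙ z → z ∙ u ∙ z ⁻¹ ≈ u
  commute⇒conj-fixed {z} {u} comm = trans (∙-congʳ comm) (y∙x∙x⁻¹≈y z u)

  intertwine-⁻¹ : ∀ {x y z} → x ∙ y ≈ y ∙ z → y ⁻¹ ∙ x ≈ z ∙ y ⁻¹
  intertwine-⁻¹ {x} {y} {z} xy≈yz = begin
    y ⁻¹ ∙ x                  ≈⟨ y∙x∙x⁻¹≈y y _ ⟨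
    y ⁻¹ ∙ x ∙ y ∙ y ⁻¹       ≈⟨ ∙-congʳ (assoc _ _ _) ⟩
    y ⁻¹ ∙ (x ∙ y) ∙ y ⁻¹     ≈⟨ ∙-congʳ (∙-congˡ xy≈yz) ⟩
    y ⁻¹ ∙ (y ∙ z) ∙ y ⁻¹     ≈⟨ ∙-congʳ (x⁻¹∙[x∙y]≈y y z) ⟩
    z ∙ y ⁻¹                  ∎

  intertwine-∙ : ∀ {x y z s t} → x ∙ s ≈ s ∙ y → y ∙ t ≈ t ∙ z →
                 x ∙ (s ∙ t) ≈ (s ∙ t) ∙ z
  intertwine-∙ {x} {y} {z} {s} {t} xs≈sy yt≈tz = begin
    x ∙ (s ∙ t)     ≈⟨ assoc _ _ _ ⟨
    x ∙ s ∙ t       ≈⟨ ∙-congʳ xs≈sy ⟩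
    s ∙ y ∙ t       ≈⟨ assoc _ _ _ ⟩
    s ∙ (y ∙ t)     ≈⟨ ∙-congˡ yt≈tz ⟩
    s ∙ (t ∙ z)     ≈⟨ assoc _ _ _ ⟨
    s ∙ t ∙ z       ∎

  intertwiners-differ-by-commuting : ∀ {x y s t} → x ∙ s ≈ s ∙ y → x ∙ t ≈ t ∙ y →
                                     t ⁻¹ ∙ s ∙ y ≈ y ∙ (t ⁻¹ ∙ s)
  intertwiners-differ-by-commuting {x} {y} {s} {t} xs≈sy xt≈ty = begin
    t ⁻¹ ∙ s ∙ y      ≈⟨ assoc _ _ _ ⟩
    t ⁻¹ ∙ (s ∙ y)    ≈⟨ ∙-congˡ xs≈sy ⟨
    t ⁻¹ ∙ (x ∙ s)    ≈⟨ assoc _ _ _ ⟨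
    t ⁻¹ ∙ x ∙ s      ≈⟨ ∙-congʳ (intertwine-⁻¹ xt≈ty) ⟩
    y ∙ t ⁻¹ ∙ s      ≈⟨ assoc _ _ _ ⟩
    y ∙ (t ⁻¹ ∙ s)    ∎

  x∙[y⁻¹∙x]⁻¹≈y : ∀ x y → x ∙ (y ⁻¹ ∙ x) ⁻¹ ≈ y
  x∙[y⁻¹∙x]⁻¹≈y x y = begin
    x ∙ (y ⁻¹ ∙ x) ⁻¹         ≈⟨ ∙-congˡ (⁻¹-anti-homo-∙ _ _) ⟩
    x ∙ (x ⁻¹ ∙ y ⁻¹ ⁻¹)      ≈⟨ x∙[x⁻¹∙y]≈y x _ ⟩
    y ⁻¹ ⁻¹                   ≈⟨ ⁻¹-involutive y ⟩
    y                         ∎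

  -- Moving between representatives of left cosets:  if g⁻¹h, g⁻¹x ∈ H then h⁻¹x ∈ H.
  [g⁻¹∙h]⁻¹∙[g⁻¹∙x]≈h⁻¹∙x : ∀ g h x → (g ⁻¹ ∙ h) ⁻¹ ∙ (g ⁻¹ ∙ x) ≈ h ⁻¹ ∙ x
  [g⁻¹∙h]⁻¹∙[g⁻¹∙x]≈h⁻¹∙x g h x = begin
    (g ⁻¹ ∙ h) ⁻¹ ∙ (g ⁻¹ ∙ x)      ≈⟨ ∙-congʳ (⁻¹-anti-homo-∙ _ _) ⟩
    h ⁻¹ ∙ g ⁻¹ ⁻¹ ∙ (g ⁻¹ ∙ x)     ≈⟨ assoc _ _ _ ⟩
    h ⁻¹ ∙ (g ⁻¹ ⁻¹ ∙ (g ⁻¹ ∙ x))   ≈⟨ ∙-congˡ (x⁻¹∙[x∙y]≈y (g ⁻¹) x) ⟩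
    h ⁻¹ ∙ x                        ∎

  g⁻¹∙[g∙u∙g⁻¹]≈u∙g⁻¹ : ∀ g u → g ⁻¹ ∙ (g ∙ u ∙ g ⁻¹) ≈ u ∙ g ⁻¹
  g⁻¹∙[g∙u∙g⁻¹]≈u∙g⁻¹ g u = trans (sym (assoc _ _ _)) (∙-congʳ (x⁻¹∙[x∙y]≈y g u))

  g∙[g⁻¹∙x∙g]∙g⁻¹≈x : ∀ g x → g ∙ (g ⁻¹ ∙ x ∙ g) ∙ g ⁻¹ ≈ x
  g∙[g⁻¹∙x∙g]∙g⁻¹≈x g x = begin
    g ∙ (g ⁻¹ ∙ x ∙ g) ∙ g ⁻¹     ≈⟨ ∙-congʳ (assoc _ _ _) ⟨
    g ∙ (g ⁻¹ ∙ x) ∙ g ∙ g ⁻¹     ≈⟨ y∙x∙x⁻¹≈y g _ ⟩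
    g ∙ (g ⁻¹ ∙ x)                ≈⟨ x∙[x⁻¹∙y]≈y g x ⟩
    x                             ∎

  g⁻¹∙[x∙y]≈[g⁻¹∙x∙g]∙[g⁻¹∙y] : ∀ g x y → g ⁻¹ ∙ (x ∙ y) ≈ (g ⁻¹ ∙ x ∙ g) ∙ (g ⁻¹ ∙ y)
  g⁻¹∙[x∙y]≈[g⁻¹∙x∙g]∙[g⁻¹∙y] g x y = sym (begin
    g ⁻¹ ∙ x ∙ g ∙ (g ⁻¹ ∙ y)     ≈⟨ assoc _ _ _ ⟩
    g ⁻¹ ∙ x ∙ (g ∙ (g ⁻¹ ∙ y))   ≈⟨ ∙-congˡ (x∙[x⁻¹∙y]≈y g y) ⟩
    g ⁻¹ ∙ x ∙ y                  ≈⟨ assoc _ _ _ ⟩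
    g ⁻¹ ∙ (x ∙ y)                ∎)

  [g∙x∙g⁻¹]∙[g∙g∙y]≈[g∙x]∙[g∙y] : ∀ g x y →
    (g ∙ x ∙ g ⁻¹) ∙ (g ∙ g ∙ y) ≈ (g ∙ x) ∙ (g ∙ y)
  [g∙x∙g⁻¹]∙[g∙g∙y]≈[g∙x]∙[g∙y] g x y = begin
    g ∙ x ∙ g ⁻¹ ∙ (g ∙ g ∙ y)        ≈⟨ ∙-congˡ (assoc _ _ _) ⟩
    g ∙ x ∙ g ⁻¹ ∙ (g ∙ (g ∙ y))      ≈⟨ assoc _ _ _ ⟩
    g ∙ x ∙ (g ⁻¹ ∙ (g ∙ (g ∙ y)))    ≈⟨ ∙-congˡ (x⁻¹∙[x∙y]≈y g _) ⟩
    g ∙ x ∙ (g ∙ y)                   ∎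

  [g∙[g∙u∙g⁻¹]∙g⁻¹]∙[g∙g]≈[g∙g]∙u : ∀ g u →
    (g ∙ (g ∙ u ∙ g ⁻¹) ∙ g ⁻¹) ∙ (g ∙ g) ≈ (g ∙ g) ∙ u
  [g∙[g∙u∙g⁻¹]∙g⁻¹]∙[g∙g]≈[g∙g]∙u g u = begin
    g ∙ (g ∙ u ∙ g ⁻¹) ∙ g ⁻¹ ∙ (g ∙ g)   ≈⟨ assoc _ _ _ ⟨
    g ∙ (g ∙ u ∙ g ⁻¹) ∙ g ⁻¹ ∙ g ∙ g     ≈⟨ ∙-congʳ (y∙x⁻¹∙x≈y g _) ⟩
    g ∙ (g ∙ u ∙ g ⁻¹) ∙ g                ≈⟨ assoc _ _ _ ⟩
    g ∙ (g ∙ u ∙ g ⁻¹ ∙ g)                ≈⟨ ∙-congˡ (y∙x⁻¹∙x≈y g _) ⟩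
    g ∙ (g ∙ u)                           ≈⟨ assoc _ _ _ ⟨
    g ∙ g ∙ u                             ∎

module CentreFacts {a ℓ : Level} (V : Group a ℓ) where
  open Group V
  open Identities V
  open SetoidReasoning setoid

  central-⁻¹ : ∀ {z} → Central V z → Central V (z ⁻¹)
  central-⁻¹ z-central w = intertwine-⁻¹ (sym (z-central w))

  central-square : ∀ v {y} → Central V y → (v ∙ y) ∙ (v ∙ y) ≈ (v ∙ v) ∙ (y ∙ y)
  central-square v {y} y-central = begin
    v ∙ y ∙ (v ∙ y)       ≈⟨ assoc _ _ _ ⟩
    v ∙ (y ∙ (v ∙ y))     ≈⟨ ∙-congˡ (assoc _ _ _) ⟨
    v ∙ (y ∙ v ∙ y)       ≈⟨ ∙-congˡ (∙-congʳ (y-central v)) ⟩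
    v ∙ (v ∙ y ∙ y)       ≈⟨ ∙-congˡ (assoc _ _ _) ⟩
    v ∙ (v ∙ (y ∙ y))     ≈⟨ assoc _ _ _ ⟨
    v ∙ v ∙ (y ∙ y)       ∎

module _ {a ℓ c₂ ℓ₂ : Level} {G : Group a ℓ} {V : Group c₂ ℓ₂}
         {φ : Group.Carrier G → Group.Carrier V} where
  private
    module G = Group G
    module V = Group V
    module VI = Identities V

  ∙-homo⇒isGroupHom : (∀ {x y} → x G.≈ y → φ x V.≈ φ y) →
                      (∀ x y → φ (x G.∙ y) V.≈ φ x V.∙ φ y) → IsGroupHom G V φ
  ∙-homo⇒isGroupHom φ-cong φ-∙ = record
    { isMonoidHomomorphism = record
      { isMagmaHomomorphism = record
        { isRelHomomorphism = record { cong = φ-cong }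
        ; homo = φ-∙ }
      ; ε-homo = φ-ε }
    ; ⁻¹-homo = φ-⁻¹ }
    where
    φ-ε : φ G.ε V.≈ V.ε
    φ-ε = VI.identityˡ-unique (φ G.ε) (φ G.ε)
            (V.trans (V.sym (φ-∙ G.ε G.ε)) (φ-cong (G.identityˡ G.ε)))

    φ-⁻¹ : ∀ x → φ (x G.⁻¹) V.≈ φ x V.⁻¹
    φ-⁻¹ x = VI.inverseˡ-unique (φ (x G.⁻¹)) (φ x)
               (V.trans (V.sym (φ-∙ (x G.⁻¹) x)) (V.trans (φ-cong (G.inverseˡ x)) φ-ε))

module SubgroupFacts {a ℓ p : Level} {G : Group a ℓ} (H : Subgroup G p) where
  open Group G
  open Subgroup H
  open Identities G

  mem-⁻¹ : ∀ {x} → mem (x ⁻¹) → mem x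
  mem-⁻¹ {x} x⁻¹∈ = mem-resp (⁻¹-involutive x) (⁻¹-closed x⁻¹∈)

  mem-cancelˡ : ∀ {x y} → mem x → mem (x ∙ y) → mem y
  mem-cancelˡ {x} {y} x∈ xy∈ = mem-resp (x⁻¹∙[x∙y]≈y x y) (∙-closed (⁻¹-closed x∈) xy∈)

  mem-cancelʳ : ∀ {x y} → mem y → mem (x ∙ y) → mem x
  mem-cancelʳ {x} {y} y∈ xy∈ = mem-resp (y∙x∙x⁻¹≈y y x) (∙-closed xy∈ (⁻¹-closed y∈))

module IndexTwoFacts {a ℓ p : Level} {G : Group a ℓ} {H : Subgroup G p}
                     (idx : IndexTwo H) where
  open Group G
  open Subgroup H
  open Identities G
  open SubgroupFacts H

  -- The representative g₀ given by IndexTwo can be replaced by any g ∉ H.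
  coset-dichotomy : ∀ {g} → ¬ mem g → ∀ x → mem x ⊎ mem (g ⁻¹ ∙ x)
  coset-dichotomy = change-representative idx
    where
    change-representative : IndexTwo H → ∀ {g} → ¬ mem g → ∀ x → mem x ⊎ mem (g ⁻¹ ∙ x)
    change-representative (g₀ , _ , cover) {g} g∉ x with cover g | cover x
    ... | inj₁ g∈     | _           = ⊥-elim (g∉ g∈)
    ... | inj₂ _      | inj₁ x∈     = inj₁ x∈
    ... | inj₂ g₀⁻¹g∈ | inj₂ g₀⁻¹x∈ =
      inj₂ (mem-resp ([g⁻¹∙h]⁻¹∙[g⁻¹∙x]≈h⁻¹∙x g₀ g x) (∙-closed (⁻¹-closed g₀⁻¹g∈) g₀⁻¹x∈))

  coset-disjoint : ∀ {g x} → ¬ mem g → mem x → ¬ mem (g ⁻¹ ∙ x)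
  coset-disjoint g∉ x∈ g⁻¹x∈ = g∉ (mem-⁻¹ (mem-cancelʳ x∈ g⁻¹x∈))

  square-mem : ∀ {g} → ¬ mem g → mem (g ∙ g)
  square-mem {g} g∉ with coset-dichotomy g∉ (g ∙ g)
  ... | inj₁ gg∈   = gg∈
  ... | inj₂ g⁻¹gg∈ = ⊥-elim (g∉ (mem-resp (x⁻¹∙[x∙y]≈y g g) g⁻¹gg∈))

  conj-closed : ∀ {g u} → ¬ mem g → mem u → mem (g ∙ u ∙ g ⁻¹)
  conj-closed {g} {u} g∉ u∈ with coset-dichotomy g∉ (g ∙ u ∙ g ⁻¹)
  ... | inj₁ conj∈ = conj∈
  ... | inj₂ h     = ⊥-elim (g∉ (mem-⁻¹ (mem-cancelˡ u∈ (mem-resp (g⁻¹∙[g∙u∙g⁻¹]≈u∙g⁻¹ g u) h))))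

  conj⁻¹-closed : ∀ {g u} → ¬ mem g → mem u → mem (g ⁻¹ ∙ u ∙ g)
  conj⁻¹-closed {g} {u} g∉ u∈ =
    mem-resp (∙-congˡ (⁻¹-involutive g)) (conj-closed (λ g⁻¹∈ → g∉ (mem-⁻¹ g⁻¹∈)) u∈)

module IndexTwoExtension {a ℓ p c₂ ℓ₂ : Level} {G : Group a ℓ} (V : Group c₂ ℓ₂)
    {H : Subgroup G p} (idx : IndexTwo H)
    {μ : Group.Carrier G} (μ∉ : ¬ Subgroup.mem H μ)
    (ψ-hom : SubgroupHom H V) where
  private
    module G = Group G
    module GI = Identities G
  open Group V
  open Identities V
  open Subgroup H
  open SubgroupHom ψ-hom renaming (f to ψ; f-cong to ψ-cong; f-∙ to ψ-∙)
  open IndexTwoFacts {G = G} {H = H} idx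
  open SetoidReasoning setoid

  μ²∈ : mem (μ G.∙ μ)
  μ²∈ = square-mem μ∉

  Intertwines : Carrier → Set _
  Intertwines w = ∀ u (u∈ : mem u) → ψ (μ G.∙ u G.∙ μ G.⁻¹) (conj-closed μ∉ u∈) ∙ w ≈ w ∙ ψ u u∈

  module Extension (w : Carrier) (w-intertwines : Intertwines w)
                   (w-square : w ∙ w ≈ ψ (μ G.∙ μ) μ²∈) where

    extend-on : ∀ x → mem x ⊎ mem (μ G.⁻¹ G.∙ x) → Carrier
    extend-on x (inj₁ x∈)    = ψ x x∈
    extend-on x (inj₂ μ⁻¹x∈) = w ∙ ψ _ μ⁻¹x∈

    φ : G.Carrier → Carrier
    φ x = extend-on x (coset-dichotomy μ∉ x)

    φ-on-H : ∀ x (x∈ : mem x) → φ x ≈ ψ x x∈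
    φ-on-H x x∈ with coset-dichotomy μ∉ x
    ... | inj₁ x∈′   = ψ-cong x∈′ x∈ G.refl
    ... | inj₂ μ⁻¹x∈ = ⊥-elim (coset-disjoint μ∉ x∈ μ⁻¹x∈)

    φ-on-μH : ∀ x (μ⁻¹x∈ : mem (μ G.⁻¹ G.∙ x)) → φ x ≈ w ∙ ψ _ μ⁻¹x∈
    φ-on-μH x μ⁻¹x∈ with coset-dichotomy μ∉ x
    ... | inj₁ x∈     = ⊥-elim (coset-disjoint μ∉ x∈ μ⁻¹x∈)
    ... | inj₂ μ⁻¹x∈′ = ∙-congˡ (ψ-cong μ⁻¹x∈′ μ⁻¹x∈ G.refl)

    w-intertwines⁻¹ : ∀ x (x∈ : mem x) → ψ x x∈ ∙ w ≈ w ∙ ψ _ (conj⁻¹-closed μ∉ x∈)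
    w-intertwines⁻¹ x x∈ = begin
      ψ x x∈ ∙ w                    ≈⟨ ∙-congʳ (ψ-cong x∈ _ (G.sym (GI.g∙[g⁻¹∙x∙g]∙g⁻¹≈x μ x))) ⟩
      ψ _ (conj-closed μ∉ x′∈) ∙ w  ≈⟨ w-intertwines _ x′∈ ⟩
      w ∙ ψ _ x′∈                   ∎
      where x′∈ = conj⁻¹-closed μ∉ x∈

    φ-cong : ∀ {x y} → x G.≈ y → φ x ≈ φ y
    φ-cong {x} {y} x≈y = by-coset (coset-dichotomy μ∉ x)
      where
      by-coset : mem x ⊎ mem (μ G.⁻¹ G.∙ x) → φ x ≈ φ y
      by-coset (inj₁ x∈) = let y∈ = mem-resp x≈y x∈ in
        trans (φ-on-H x x∈) (trans (ψ-cong x∈ y∈ x≈y) (sym (φ-on-H y y∈)))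
      by-coset (inj₂ μ⁻¹x∈) = let μ⁻¹y∈ = mem-resp (G.∙-congˡ x≈y) μ⁻¹x∈ in
        trans (φ-on-μH x μ⁻¹x∈)
          (trans (∙-congˡ (ψ-cong μ⁻¹x∈ μ⁻¹y∈ (G.∙-congˡ x≈y))) (sym (φ-on-μH y μ⁻¹y∈)))

    φ-∙-H-H : ∀ {x y} (x∈ : mem x) (y∈ : mem y) → φ (x G.∙ y) ≈ φ x ∙ φ y
    φ-∙-H-H {x} {y} x∈ y∈ = begin
      φ (x G.∙ y)              ≈⟨ φ-on-H _ (∙-closed x∈ y∈) ⟩
      ψ _ (∙-closed x∈ y∈)     ≈⟨ ψ-∙ x∈ y∈ ⟩
      ψ x x∈ ∙ ψ y y∈          ≈⟨ ∙-cong (φ-on-H x x∈) (φ-on-H y y∈) ⟨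
      φ x ∙ φ y                ∎

    φ-∙-H-μH : ∀ {x y} (x∈ : mem x) (b∈ : mem (μ G.⁻¹ G.∙ y)) → φ (x G.∙ y) ≈ φ x ∙ φ y
    φ-∙-H-μH {x} {y} x∈ b∈ = begin
      φ (x G.∙ y)               ≈⟨ φ-on-μH _ xy∈ ⟩
      w ∙ ψ _ xy∈               ≈⟨ ∙-congˡ (ψ-cong xy∈ _ (GI.g⁻¹∙[x∙y]≈[g⁻¹∙x∙g]∙[g⁻¹∙y] μ x y)) ⟩
      w ∙ ψ _ (∙-closed x′∈ b∈) ≈⟨ ∙-congˡ (ψ-∙ x′∈ b∈) ⟩
      w ∙ (ψ _ x′∈ ∙ ψ _ b∈)    ≈⟨ assoc _ _ _ ⟨
      w ∙ ψ _ x′∈ ∙ ψ _ b∈      ≈⟨ ∙-congʳ (w-intertwines⁻¹ x x∈) ⟨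
      ψ x x∈ ∙ w ∙ ψ _ b∈       ≈⟨ assoc _ _ _ ⟩
      ψ x x∈ ∙ (w ∙ ψ _ b∈)     ≈⟨ ∙-cong (φ-on-H x x∈) (φ-on-μH y b∈) ⟨
      φ x ∙ φ y                 ∎
      where
      x′∈ = conj⁻¹-closed μ∉ x∈
      xy∈ = mem-resp (G.sym (GI.g⁻¹∙[x∙y]≈[g⁻¹∙x∙g]∙[g⁻¹∙y] μ x y)) (∙-closed x′∈ b∈)

    φ-∙-μH-H : ∀ {x y} (a∈ : mem (μ G.⁻¹ G.∙ x)) (y∈ : mem y) → φ (x G.∙ y) ≈ φ x ∙ φ y
    φ-∙-μH-H {x} {y} a∈ y∈ = begin
      φ (x G.∙ y)              ≈⟨ φ-on-μH _ xy∈ ⟩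
      w ∙ ψ _ xy∈              ≈⟨ ∙-congˡ (ψ-cong xy∈ _ (G.sym (G.assoc _ _ _))) ⟩
      w ∙ ψ _ (∙-closed a∈ y∈) ≈⟨ ∙-congˡ (ψ-∙ a∈ y∈) ⟩
      w ∙ (ψ _ a∈ ∙ ψ y y∈)    ≈⟨ assoc _ _ _ ⟨
      w ∙ ψ _ a∈ ∙ ψ y y∈      ≈⟨ ∙-cong (φ-on-μH x a∈) (φ-on-H y y∈) ⟨
      φ x ∙ φ y                ∎
      where xy∈ = mem-resp (G.assoc _ _ _) (∙-closed a∈ y∈)

    -- x y ∈ H  with  x y = (μ a μ⁻¹)(μ² b)  for  a = μ⁻¹x,  b = μ⁻¹y;
    -- here w² = ψ(μ²) is used.
    φ-∙-μH-μH : ∀ {x y} (a∈ : mem (μ G.⁻¹ G.∙ x)) (b∈ : mem (μ G.⁻¹ G.∙ y)) →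
                φ (x G.∙ y) ≈ φ x ∙ φ y
    φ-∙-μH-μH {x} {y} a∈ b∈ = begin
      φ (x G.∙ y)                     ≈⟨ φ-on-H _ xy∈ ⟩
      ψ _ xy∈                         ≈⟨ ψ-cong xy∈ _ (G.sym xy≈) ⟩
      ψ _ (∙-closed a′∈ μ²b∈)         ≈⟨ ψ-∙ a′∈ μ²b∈ ⟩
      ψ _ a′∈ ∙ ψ _ μ²b∈              ≈⟨ ∙-congˡ (ψ-∙ μ²∈ b∈) ⟩
      ψ _ a′∈ ∙ (ψ _ μ²∈ ∙ ψ _ b∈)    ≈⟨ ∙-congˡ (∙-congʳ w-square) ⟨
      ψ _ a′∈ ∙ (w ∙ w ∙ ψ _ b∈)      ≈⟨ ∙-congˡ (assoc _ _ _) ⟩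
      ψ _ a′∈ ∙ (w ∙ (w ∙ ψ _ b∈))    ≈⟨ assoc _ _ _ ⟨
      ψ _ a′∈ ∙ w ∙ (w ∙ ψ _ b∈)      ≈⟨ ∙-congʳ (w-intertwines _ a∈) ⟩
      w ∙ ψ _ a∈ ∙ (w ∙ ψ _ b∈)       ≈⟨ ∙-cong (φ-on-μH x a∈) (φ-on-μH y b∈) ⟨
      φ x ∙ φ y                       ∎
      where
      a′∈  = conj-closed μ∉ a∈
      μ²b∈ = ∙-closed μ²∈ b∈
      xy≈ : (μ G.∙ (μ G.⁻¹ G.∙ x) G.∙ μ G.⁻¹) G.∙ (μ G.∙ μ G.∙ (μ G.⁻¹ G.∙ y)) G.≈ x G.∙ y
      xy≈ = G.trans (GI.[g∙x∙g⁻¹]∙[g∙g∙y]≈[g∙x]∙[g∙y] μ _ _)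
                    (G.∙-cong (GI.x∙[x⁻¹∙y]≈y μ x) (GI.x∙[x⁻¹∙y]≈y μ y))
      xy∈ = mem-resp xy≈ (∙-closed a′∈ μ²b∈)

    φ-∙ : ∀ x y → φ (x G.∙ y) ≈ φ x ∙ φ y
    φ-∙ x y = by-cosets (coset-dichotomy μ∉ x) (coset-dichotomy μ∉ y)
      where
      by-cosets : mem x ⊎ mem (μ G.⁻¹ G.∙ x) → mem y ⊎ mem (μ G.⁻¹ G.∙ y) →
                  φ (x G.∙ y) ≈ φ x ∙ φ y
      by-cosets (inj₁ x∈) (inj₁ y∈) = φ-∙-H-H x∈ y∈
      by-cosets (inj₁ x∈) (inj₂ b∈) = φ-∙-H-μH x∈ b∈
      by-cosets (inj₂ a∈) (inj₁ y∈) = φ-∙-μH-H a∈ y∈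
      by-cosets (inj₂ a∈) (inj₂ b∈) = φ-∙-μH-μH a∈ b∈

    extension : Σ (G.Carrier → Carrier) λ φ → IsGroupHom G V φ ×
                  (∀ u (u∈ : mem u) → φ u ≈ ψ u u∈)
    extension = φ , ∙-homo⇒isGroupHom {G = G} {V = V} φ-cong φ-∙ , φ-on-H

  module Correction
      (centre-divisible : CentreTwoDivisible V)
      (centraliser : ∀ z → (∀ u (u∈ : mem u) → z ∙ ψ u u∈ ∙ z ⁻¹ ≈ ψ u u∈) ⇔ Central V z)
      (v : Carrier) (v-intertwines : Intertwines v) where
    open CentreFacts V

    -- ψ(μ²) and v² both intertwine ψ^{μ²} with ψ, hence z = ψ(μ²)⁻¹ v²
    -- commutes with ψ(H).
    z : Carrier
    z = ψ _ μ²∈ ⁻¹ ∙ (v ∙ v)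

    z-commutes : ∀ u (u∈ : mem u) → z ∙ ψ u u∈ ≈ ψ u u∈ ∙ z
    z-commutes u u∈ = intertwiners-differ-by-commuting v²-intertwines ψμ²-intertwines
      where
      u₁∈ = conj-closed μ∉ u∈
      u₂∈ = conj-closed μ∉ u₁∈
      v²-intertwines : ψ _ u₂∈ ∙ (v ∙ v) ≈ (v ∙ v) ∙ ψ u u∈
      v²-intertwines = intertwine-∙ (v-intertwines _ u₁∈) (v-intertwines u u∈)
      ψμ²-intertwines : ψ _ u₂∈ ∙ ψ _ μ²∈ ≈ ψ _ μ²∈ ∙ ψ u u∈
      ψμ²-intertwines = begin
        ψ _ u₂∈ ∙ ψ _ μ²∈         ≈⟨ ψ-∙ u₂∈ μ²∈ ⟨
        ψ _ (∙-closed u₂∈ μ²∈)    ≈⟨ ψ-cong _ (∙-closed μ²∈ u∈) (GI.[g∙[g∙u∙g⁻¹]∙g⁻¹]∙[g∙g]≈[g∙g]∙u μ u) ⟩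
        ψ _ (∙-closed μ²∈ u∈)     ≈⟨ ψ-∙ μ²∈ u∈ ⟩
        ψ _ μ²∈ ∙ ψ u u∈          ∎

    z⁻¹-central : Central V (z ⁻¹)
    z⁻¹-central = central-⁻¹ (Equivalence.to (centraliser z)
                    (λ u u∈ → commute⇒conj-fixed (z-commutes u u∈)))

    -- Twisting v by a central square root of z⁻¹ fixes the square.
    corrected : ∃ λ w → Intertwines w × (w ∙ w ≈ ψ _ μ²∈)
    corrected with centre-divisible (z ⁻¹) z⁻¹-central
    ... | y , y-central , y²≈z⁻¹ = v ∙ y , w-intertwines , w-square
      where
      w-intertwines : Intertwines (v ∙ y)
      w-intertwines u u∈ = intertwine-∙ (v-intertwines u u∈) (sym (y-central (ψ u u∈)))
      w-square : (v ∙ y) ∙ (v ∙ y) ≈ ψ _ μ²∈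
      w-square = begin
        v ∙ y ∙ (v ∙ y)     ≈⟨ central-square v y-central ⟩
        v ∙ v ∙ (y ∙ y)     ≈⟨ ∙-congˡ y²≈z⁻¹ ⟩
        v ∙ v ∙ z ⁻¹        ≈⟨ x∙[y⁻¹∙x]⁻¹≈y (v ∙ v) (ψ _ μ²∈) ⟩
        ψ _ μ²∈             ∎

lemma3p4 : {c ℓ c₂ ℓ₂ p : Level} (U : Group c ℓ) (V : Group c₂ ℓ₂) →
    CentreTwoDivisible V →
    (U′ : Subgroup U p) → IndexTwo U′ →
    (μ : Group.Carrier U) → ¬ Subgroup.mem U′ μ →
    (ψ : SubgroupHom U′ V) →
    (∀ v → (∀ u (hu : Subgroup.mem U′ u) →
              Group._≈_ V (Group._∙_ V (Group._∙_ V v (SubgroupHom.f ψ u hu)) (Group._⁻¹ V v))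
                          (SubgroupHom.f ψ u hu))
           ⇔ Central V v) →
    (∃ λ v → ∀ u (hu : Subgroup.mem U′ u)
              (hμu : Subgroup.mem U′ (Group._∙_ U (Group._∙_ U μ u) (Group._⁻¹ U μ))) →
              Group._≈_ V (SubgroupHom.f ψ (Group._∙_ U (Group._∙_ U μ u) (Group._⁻¹ U μ)) hμu)
                          (Group._∙_ V (Group._∙_ V v (SubgroupHom.f ψ u hu)) (Group._⁻¹ V v))) →
    Σ (Group.Carrier U → Group.Carrier V) λ φ →
      IsGroupHom U V φ ×
      (∀ u (hu : Subgroup.mem U′ u) → Group._≈_ V (φ u) (SubgroupHom.f ψ u hu))
lemma3p4 U V centre-divisible U′ idx μ μ∉ ψ centraliser (v , ψ^μ≈vψv⁻¹) =
  let (w , w-intertwines , w-square) =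
        Correction.corrected centre-divisible centraliser v v-intertwines
  in  Extension.extension w w-intertwines w-square
  where
  open IndexTwoExtension V idx μ∉ ψ
  v-intertwines : Intertwines v
  v-intertwines u u∈ = Identities.conj⇒intertwine V (ψ^μ≈vψv⁻¹ u u∈ _)
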